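{- Let $\mathbf{a}$ be a weak $m$-part composition of $n$ and let $t=(n,l)$ with $0\le l<m$. Let $\mathscr{G}^*(\mathbf{a},t)$ be the set of good LPBPs $(P,(\mathbf{a},j))$ in which $P$ is a path from $(0,0)$ to $t$ whose last step is a right step. Then $|\mathscr{G}^*(\mathbf{a},t)|=\binom{n+l-1}{l}(m-l)$.
   Context: Lattice paths use unit steps $(0,1)$ (up) and $(1,0)$ (right). $\mathbf{a}=(a_0,\ldots,a_{m-1})$ is a tuple of nonnegative integers summing to $n$; indices read mod $m$. Let $f_{\mathbf{a}}(y)=a_r(y-r)+\sum_{j=0}^{r-1}a_j$ for $y\in[r,r+1]$, $0\le r<m$. A lattice point $(x,y)$ with $0\le y\le m$ is dominated by $\mathbf{a}$ if $x\ge f_{\mathbf{a}}(y)$; a path is dominated if all its lattice points are. Cyclic shifts: $\mathbf{a}^{j}=(a_{ -j},\ldots,a_{ -j+m-1})$. An LPBP is a pair $(P,(\mathbf{a},j))$ with $P$ a lattice path from the origin and $0\le j<m$; it is good if $P$ is dominated by $\mathbf{a}^j$. -}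

module Defs where

open import Data.Nat using (ℕ; zero; suc; _+_; _∸_; _≤_)
open import Data.Nat.DivMod using (_mod_)
open import Data.Fin using (Fin; toℕ)
import Data.Fin as Fin
open import Data.List using (List; []; _∷_; _++_; [_])
open import Data.List.Relation.Unary.All using (All)
open import Data.Product using (_×_; _,_; Σ; ∃)
open import Relation.Binary.PropositionalEquality using (_≡_)

-- A weak m-part composition is a function  a : Fin m → ℕ  (entries a_0..a_{m-1}).

-- psum a y = a_0 + ... + a_{y-1}  (truncated at m); this is f_a(y) for integer y ∈ [0,m].
psum : ∀ {m} → (Fin m → ℕ) → ℕ → ℕ
psum {zero}  a y       = 0
psum {suc m} a zero    = 0
psum {suc m} a (suc y) = a Fin.zero + psum (λ i → a (Fin.suc i)) y

total : ∀ {m} → (Fin m → ℕ) → ℕ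
total {m} a = psum a m

-- cyclic shift a^j : (a^j)_i = a_{i - j mod m}
shift : ∀ {m} → (Fin m → ℕ) → Fin m → (Fin m → ℕ)
shift {zero}  a j i = a i
shift {suc k} a j i = a ((toℕ i + (suc k ∸ toℕ j)) mod (suc k))

data Step : Set where
  U : Step
  R : Step

pointsFrom : ℕ × ℕ → List Step → List (ℕ × ℕ)
pointsFrom p         []       = p ∷ []
pointsFrom (x , y) (U ∷ s)  = (x , y) ∷ pointsFrom (x , suc y) s
pointsFrom (x , y) (R ∷ s)  = (x , y) ∷ pointsFrom (suc x , y) s

points : List Step → List (ℕ × ℕ)
points = pointsFrom (0 , 0)

endFrom : ℕ × ℕ → List Step → ℕ × ℕ
endFrom p       []       = p
endFrom (x , y) (U ∷ s)  = endFrom (x , suc y) s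
endFrom (x , y) (R ∷ s)  = endFrom (suc x , y) s

endpoint : List Step → ℕ × ℕ
endpoint = endFrom (0 , 0)

DominatedPt : ∀ {m} → (Fin m → ℕ) → ℕ × ℕ → Set
DominatedPt {m} a (x , y) = (y ≤ m) × (psum a y ≤ x)

Dominated : ∀ {m} → (Fin m → ℕ) → List Step → Set
Dominated a P = All (DominatedPt a) (points P)

Good : ∀ {m} → (Fin m → ℕ) → List Step → Fin m → Set
Good a P j = Dominated (shift a j) P

GStar : ∀ {m} → (Fin m → ℕ) → ℕ × ℕ → Set
GStar {m} a t =
  Σ (List Step × Fin m) λ { (P , j) →
    (endpoint P ≡ t) × (∃ λ Q → P ≡ Q ++ [ R ]) × Good a P j }

module Submission where

-- Encode a path P = Q R from the origin and the boundary B of a cyclic shift a^j as one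
-- "merged" word, read column by column, over three letters: bUp (an up step of the
-- boundary), pUp (an up step of the path) and rt (a right step shared by both).  Then
-- (1) P is dominated by a^j iff the merged word satisfies a ballot condition (never more
--     pUps than bUps in a prefix);
-- (2) the boundary of a^j rotated after its first j up steps is the boundary of a, and
--     rotating merged words after their bUps permutes the paths Q to (n-1, l), so that
--     goodness for a^j becomes the ballot condition for a rotation of the merged word
--     against a;
-- (3) by the cycle lemma, a word with m bUps and l ≤ m pUps has exactly m - l rotations
--     (after each of its bUps) satisfying the ballot condition.
-- Hence |G*(a, (n, l))| = #{paths Q to (n-1, l)} · (m - l) = C(n+l-1, l) · (m - l).

open import Defs
open import Data.Nat using (ℕ; zero; suc; _+_; _*_; _∸_; _≤_; _<_; z≤n; s≤s; _⊓_; pred; _≤?_; _≟_)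
open import Data.Nat.Properties
open import Data.Nat.DivMod using (_mod_; [m+n]%n≡m%n; m<n⇒m%n≡m; m%n<n)
open import Data.Nat.Combinatorics using (_C_; nCn≡1; nCk+nC[k+1]≡[n+1]C[k+1])
open import Data.Nat.Tactic.RingSolver using (solve-∀)
open import Data.Bool using (Bool; true; false; T)
open import Data.Bool.Properties using (T-irrelevant)
open import Data.Fin using (Fin; toℕ) renaming (zero to fzero; suc to fsuc)
open import Data.Fin.Properties using (toℕ<n; fromℕ<-cong; fromℕ<-toℕ; +↔⊎; *↔×; 1↔⊤; 0↔⊥)
open import Data.List
  using (List; []; _∷_; _++_; [_]; _∷ʳ_; initLast; _∷ʳ′_; replicate; map; tabulate; applyUpTo; length)
open import Data.List.Properties using (++-assoc; ++-identityʳ; ∷-injectiveʳ; ∷ʳ-injective; length-applyUpTo)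
open import Data.List.Relation.Unary.All using (All; []; _∷_) renaming (map to All-map)
import Data.List.Relation.Unary.All as All
open import Data.List.Relation.Unary.All.Properties using (map⁺; map⁻)
open import Data.Product using (_×_; _,_; Σ; proj₁; proj₂)
open import Data.Product.Properties using () renaming (≡-dec to ×-≡-dec)
open import Data.Product.Function.NonDependent.Propositional using (_×-cong_)
open import Data.Product.Function.Dependent.Propositional using (Σ-↔)
open import Data.Sum using (_⊎_; inj₁; inj₂)
open import Data.Sum.Function.Propositional using (_⊎-cong_)
open import Data.Empty using (⊥; ⊥-elim)
open import Data.Unit using (⊤; tt)
open import Function using (_∘_)
open import Function.Bundles using (_↔_; mk↔ₛ′)
open import Function.Related.Propositional using (K-refl; K-reflexive; SK-sym; module EquationalReasoning)
open import Function.Related.TypeIsomorphisms using (∃∃↔∃∃)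
open import Axiom.UniquenessOfIdentityProofs using (module Decidable⇒UIP)
open import Relation.Binary.PropositionalEquality hiding ([_])
open import Relation.Nullary using (¬_; yes; no)

b2n : Bool → ℕ
b2n true  = 1
b2n false = 0

module Marks {X : Set} (p : X → Bool) where

  count : List X → ℕ
  count []       = 0
  count (x ∷ xs) = b2n (p x) + count xs

  count-++ : ∀ u v → count (u ++ v) ≡ count u + count v
  count-++ []      v = refl
  count-++ (x ∷ u) v = trans (cong (b2n (p x) +_) (count-++ u v)) (sym (+-assoc (b2n (p x)) (count u) (count v)))

  prepend : X → List X × List X → List X × List X
  prepend x q = x ∷ proj₁ q , proj₂ q

  -- cut k w = (u , v) with u ++ v ≡ w, where u stops right after the k-th marked letter
  -- (u = w if there are fewer than k marked letters).
  cut : ℕ → List X → List X × List X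
  cut zero    w       = [] , w
  cut (suc k) []      = [] , []
  cut (suc k) (x ∷ w) with p x
  ... | true  = prepend x (cut k w)
  ... | false = prepend x (cut (suc k) w)

  rotate : ℕ → List X → List X
  rotate k w = proj₂ (cut k w) ++ proj₁ (cut k w)

  cut-reassembles : ∀ k w → proj₁ (cut k w) ++ proj₂ (cut k w) ≡ w
  cut-reassembles zero    w       = refl
  cut-reassembles (suc k) []      = refl
  cut-reassembles (suc k) (x ∷ w) with p x
  ... | true  = cong (x ∷_) (cut-reassembles k w)
  ... | false = cong (x ∷_) (cut-reassembles (suc k) w)

  count-cut : ∀ k w → k ≤ count w → count (proj₁ (cut k w)) ≡ k
  count-cut zero    w       _ = refl
  count-cut (suc k) (x ∷ w) le with p x in px
  ... | true  rewrite px = cong suc (count-cut k w (≤-pred le))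
  ... | false rewrite px = count-cut (suc k) w le

  cut-++ˡ : ∀ k u t → k ≤ count u → cut k (u ++ t) ≡ (proj₁ (cut k u) , proj₂ (cut k u) ++ t)
  cut-++ˡ zero    u       t _  = refl
  cut-++ˡ (suc k) (x ∷ u) t le with p x
  ... | true  rewrite cut-++ˡ k u t (≤-pred le) = refl
  ... | false rewrite cut-++ˡ (suc k) u t le = refl

  cut-marked : ∀ {x} k w → p x ≡ true → cut (suc k) (x ∷ w) ≡ prepend x (cut k w)
  cut-marked k w px rewrite px = refl

  cut-unmarked : ∀ {x} k w → p x ≡ false → cut (suc k) (x ∷ w) ≡ prepend x (cut (suc k) w)
  cut-unmarked k w px rewrite px = refl

  cut-++ʳ : ∀ u k t → cut (count u + suc k) (u ++ t) ≡ (u ++ proj₁ (cut (suc k) t) , proj₂ (cut (suc k) t))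
  cut-++ʳ []      k t = refl
  cut-++ʳ (x ∷ u) k t with p x in px
  ... | true  = trans (cut-marked (count u + suc k) (u ++ t) px) (cong (prepend x) (cut-++ʳ u k t))
  ... | false = begin
    cut (count u + suc k) (x ∷ u ++ t)         ≡⟨ cong (λ i → cut i (x ∷ u ++ t)) (+-suc (count u) k) ⟩
    cut (suc (count u + k)) (x ∷ u ++ t)       ≡⟨ cut-unmarked (count u + k) (u ++ t) px ⟩
    prepend x (cut (suc (count u + k)) (u ++ t)) ≡⟨ cong (λ i → prepend x (cut i (u ++ t))) (sym (+-suc (count u) k)) ⟩
    prepend x (cut (count u + suc k) (u ++ t)) ≡⟨ cong (prepend x) (cut-++ʳ u k t) ⟩
    (x ∷ u ++ proj₁ (cut (suc k) t) , proj₂ (cut (suc k) t)) ∎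
    where open ≡-Reasoning

  cut-unmarked-++ : ∀ u k t → count u ≡ 0 →
                    cut (suc k) (u ++ t) ≡ (u ++ proj₁ (cut (suc k) t) , proj₂ (cut (suc k) t))
  cut-unmarked-++ u k t cu = trans (cong (λ i → cut (i + suc k) (u ++ t)) (sym cu)) (cut-++ʳ u k t)

  EndsMarked : List X → Set
  EndsMarked w = Σ (List X) λ w′ → Σ X λ c → (w ≡ w′ ++ [ c ]) × (p c ≡ true)

  cut-EndsMarked : ∀ k w → suc k ≤ count w → EndsMarked (proj₁ (cut (suc k) w))
  cut-EndsMarked k (x ∷ w) le with p x in px
  cut-EndsMarked zero    (x ∷ w) le | true = [] , x , refl , px
  cut-EndsMarked (suc k) (x ∷ w) le | true with cut-EndsMarked k w (≤-pred le)
  ... | w′ , c , e , pc = (x ∷ w′) , c , cong (x ∷_) e , pc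
  cut-EndsMarked k (x ∷ w) le | false with cut-EndsMarked k w le
  ... | w′ , c , e , pc = (x ∷ w′) , c , cong (x ∷_) e , pc

  cut-count : ∀ y t → y ≡ [] ⊎ EndsMarked y → cut (count y) (y ++ t) ≡ (y , t)
  cut-count .[] t (inj₁ refl) = refl
  cut-count y t (inj₂ (y′ , c , refl , pc)) = begin
    cut (count (y′ ++ [ c ])) ((y′ ++ [ c ]) ++ t)         ≡⟨ cong₂ cut count-y (++-assoc y′ [ c ] t) ⟩
    cut (count y′ + 1) (y′ ++ c ∷ t)                       ≡⟨ cut-++ʳ y′ 0 (c ∷ t) ⟩
    (y′ ++ proj₁ (cut 1 (c ∷ t)) , proj₂ (cut 1 (c ∷ t)))
      ≡⟨ cong (λ q → y′ ++ proj₁ q , proj₂ q) (cut-marked 0 t pc) ⟩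
    (y′ ++ [ c ] , t)                                      ∎
    where
      open ≡-Reasoning
      count-y : count (y′ ++ [ c ]) ≡ count y′ + 1
      count-y = trans (count-++ y′ [ c ]) (cong (λ b → count y′ + (b2n b + 0)) pc)

  suffix-EndsMarked : ∀ x y → EndsMarked (x ++ y) → y ≡ [] ⊎ EndsMarked y
  suffix-EndsMarked x       []      _ = inj₁ refl
  suffix-EndsMarked []      (d ∷ y) e = inj₂ e
  suffix-EndsMarked (z ∷ x) (d ∷ y) ([] , c , eq , pc) with x | eq
  ... | []    | ()
  ... | _ ∷ _ | ()
  suffix-EndsMarked (z ∷ x) (d ∷ y) (_ ∷ w′ , c , eq , pc) =
    suffix-EndsMarked x (d ∷ y) (w′ , c , ∷-injectiveʳ eq , pc)

  rotate-inverse : ∀ m k w → count w ≡ m → k ≤ m → EndsMarked w → rotate (m ∸ k) (rotate k w) ≡ w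
  rotate-inverse m k w cw k≤m ew = begin
    rotate (m ∸ k) (y ++ x)     ≡⟨ cong (λ i → rotate i (y ++ x)) (sym count-y) ⟩
    rotate (count y) (y ++ x)   ≡⟨ cong (λ q → proj₂ q ++ proj₁ q) (cut-count y x (suffix-EndsMarked x y ew′)) ⟩
    x ++ y                      ≡⟨ cut-reassembles k w ⟩
    w                           ∎
    where
      open ≡-Reasoning
      x = proj₁ (cut k w)
      y = proj₂ (cut k w)
      ew′ : EndsMarked (x ++ y)
      ew′ = subst EndsMarked (sym (cut-reassembles k w)) ew
      count-y : count y ≡ m ∸ k
      count-y = begin
        count y                     ≡⟨ sym (m+n∸m≡n (count x) (count y)) ⟩
        count x + count y ∸ count x ≡⟨ cong₂ _∸_ (trans (sym (count-++ x y)) (trans (cong count (cut-reassembles k w)) cw))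
                                                 (count-cut k w (subst (k ≤_) (sym cw) k≤m)) ⟩
        m ∸ k                       ∎

count-rotate : ∀ {X : Set} (p q : X → Bool) k w → Marks.count q (Marks.rotate p k w) ≡ Marks.count q w
count-rotate p q k w = begin
  count (y ++ x)        ≡⟨ count-++ y x ⟩
  count y + count x     ≡⟨ +-comm (count y) (count x) ⟩
  count x + count y     ≡⟨ sym (count-++ x y) ⟩
  count (x ++ y)        ≡⟨ cong count (Marks.cut-reassembles p k w) ⟩
  count w               ∎
  where
    open ≡-Reasoning
    open Marks q using (count; count-++)
    x = proj₁ (Marks.cut p k w)
    y = proj₂ (Marks.cut p k w)

-- Letters of a merged word: an up step of the boundary, an up step of the path,
-- or a right step shared by both.
data Letter : Set where
  bUp pUp rt : Letter

isBUp isPUp isRt : Letter → Bool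
isBUp bUp = true
isBUp _   = false
isPUp pUp = true
isPUp _   = false
isRt  rt  = true
isRt  _   = false

module BUps = Marks isBUp
module PUps = Marks isPUp
module Rts  = Marks isRt

-- ballot d w: reading w from left to right with initial credit d, where bUp earns a
-- credit and pUp spends one, the credit never becomes negative.
ballot : ℕ → List Letter → Bool
ballot d       []        = true
ballot d       (bUp ∷ w) = ballot (suc d) w
ballot d       (rt ∷ w)  = ballot d w
ballot zero    (pUp ∷ w) = false
ballot (suc d) (pUp ∷ w) = ballot d w

AllRt : List Letter → Set
AllRt = All (_≡ rt)

ballot-skipRts : ∀ {r} → AllRt r → ∀ d t → ballot d (r ++ t) ≡ ballot d t
ballot-skipRts []           d t = refl
ballot-skipRts (refl ∷ ar) d t = ballot-skipRts ar d t

AllRt-noBUp : ∀ {r} → AllRt r → BUps.count r ≡ 0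
AllRt-noBUp []           = refl
AllRt-noBUp (refl ∷ ar) = AllRt-noBUp ar

ballot-cancel : ∀ {r} → AllRt r → ∀ u d v → ballot d (u ++ bUp ∷ r ++ pUp ∷ v) ≡ ballot d (u ++ r ++ v)
ballot-cancel ar []        d       v = trans (ballot-skipRts ar (suc d) (pUp ∷ v)) (sym (ballot-skipRts ar d v))
ballot-cancel ar (bUp ∷ u) d       v = ballot-cancel ar u (suc d) v
ballot-cancel ar (rt ∷ u)  d       v = ballot-cancel ar u d v
ballot-cancel ar (pUp ∷ u) zero    v = refl
ballot-cancel ar (pUp ∷ u) (suc d) v = ballot-cancel ar u d v

ballot-noPUp : ∀ v → PUps.count v ≡ 0 → ∀ d t → ballot d (v ++ t) ≡ ballot (d + BUps.count v) t
ballot-noPUp []        _ d t = cong (λ i → ballot i t) (sym (+-identityʳ d))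
ballot-noPUp (bUp ∷ v) e d t = trans (ballot-noPUp v e (suc d) t) (cong (λ i → ballot i t) (sym (+-suc d (BUps.count v))))
ballot-noPUp (rt ∷ v)  e d t = ballot-noPUp v e d t

ballot-noPUp-true : ∀ v → PUps.count v ≡ 0 → ∀ d → ballot d v ≡ true
ballot-noPUp-true []        _ d = refl
ballot-noPUp-true (bUp ∷ v) e d = ballot-noPUp-true v e (suc d)
ballot-noPUp-true (rt ∷ v)  e d = ballot-noPUp-true v e d

ballot-noBUp-pass : ∀ u → BUps.count u ≡ 0 → ∀ d t → PUps.count u ≤ d →
                    ballot d (u ++ t) ≡ ballot (d ∸ PUps.count u) t
ballot-noBUp-pass []        _ d       t _         = refl
ballot-noBUp-pass (rt ∷ u)  e d       t le        = ballot-noBUp-pass u e d t le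
ballot-noBUp-pass (pUp ∷ u) e (suc d) t (s≤s le) = ballot-noBUp-pass u e d t le

ballot-noBUp-fail : ∀ u → BUps.count u ≡ 0 → ∀ d t → d < PUps.count u → ballot d (u ++ t) ≡ false
ballot-noBUp-fail (rt ∷ u)  e d       t lt        = ballot-noBUp-fail u e d t lt
ballot-noBUp-fail (pUp ∷ u) e zero    t _         = refl
ballot-noBUp-fail (pUp ∷ u) e (suc d) t (s≤s lt) = ballot-noBUp-fail u e d t lt

data Shape (w : List Letter) : Set where
  cancellable : ∀ x r y → AllRt r → w ≡ x ++ bUp ∷ r ++ pUp ∷ y → Shape w
  sorted      : ∀ u v → BUps.count u ≡ 0 → PUps.count v ≡ 0 → w ≡ u ++ v → Shape w

StartsRtsPUp : List Letter → Set
StartsRtsPUp w = Σ (List Letter) λ r → Σ (List Letter) λ y → AllRt r × (w ≡ r ++ pUp ∷ y)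

startsRtsPUp? : ∀ w → StartsRtsPUp w ⊎ ¬ StartsRtsPUp w
startsRtsPUp? []        = inj₂ λ { ([] , _ , _ , ()) ; (_ ∷ _ , _ , _ , ()) }
startsRtsPUp? (pUp ∷ y) = inj₁ ([] , y , [] , refl)
startsRtsPUp? (bUp ∷ w) = inj₂ λ { ([] , _ , _ , ()) ; (_ ∷ _ , _ , () ∷ _ , refl) }
startsRtsPUp? (rt ∷ w) with startsRtsPUp? w
... | inj₁ (r , y , ar , e) = inj₁ (rt ∷ r , y , refl ∷ ar , cong (rt ∷_) e)
... | inj₂ ns = inj₂ λ { ([] , _ , _ , ()) ; (_ ∷ r , y , _ ∷ ar , e) → ns (r , y , ar , ∷-injectiveʳ e) }

noBUp-noStart : ∀ u v → BUps.count u ≡ 0 → ¬ StartsRtsPUp (u ++ v) → PUps.count u ≡ 0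
noBUp-noStart []        v _ _  = refl
noBUp-noStart (pUp ∷ u) v _ ns = ⊥-elim (ns ([] , u ++ v , [] , refl))
noBUp-noStart (rt ∷ u)  v e ns =
  noBUp-noStart u v e λ { (r , y , ar , eq) → ns (rt ∷ r , y , refl ∷ ar , cong (rt ∷_) eq) }

shape : ∀ w → Shape w
shape [] = sorted [] [] refl refl refl
shape (pUp ∷ w) with shape w
... | cancellable x r y ar e = cancellable (pUp ∷ x) r y ar (cong (pUp ∷_) e)
... | sorted u v cu cv e     = sorted (pUp ∷ u) v cu cv (cong (pUp ∷_) e)
shape (rt ∷ w) with shape w
... | cancellable x r y ar e = cancellable (rt ∷ x) r y ar (cong (rt ∷_) e)
... | sorted u v cu cv e     = sorted (rt ∷ u) v cu cv (cong (rt ∷_) e)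
shape (bUp ∷ w) with startsRtsPUp? w
... | inj₁ (r , y , ar , e) = cancellable [] r y ar (cong (bUp ∷_) e)
... | inj₂ ns with shape w
...   | cancellable x r y ar e = cancellable (bUp ∷ x) r y ar (cong (bUp ∷_) e)
...   | sorted u v cu cv e     = sorted [] (bUp ∷ u ++ v) refl
          (trans (PUps.count-++ u v) (cong₂ _+_ (noBUp-noStart u v cu (λ s → ns (subst StartsRtsPUp (sym e) s))) cv))
          (cong (bUp ∷_) e)

tally : (ℕ → Bool) → ℕ → ℕ
tally h zero    = 0
tally h (suc n) = b2n (h (suc n)) + tally h n

tally-cong : ∀ h h′ n → (∀ k → 1 ≤ k → k ≤ n → h k ≡ h′ k) → tally h n ≡ tally h′ n
tally-cong h h′ zero    _  = refl
tally-cong h h′ (suc n) eq = cong₂ _+_ (cong b2n (eq (suc n) (s≤s z≤n) ≤-refl))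
                                      (tally-cong h h′ n λ k a b → eq k a (m≤n⇒m≤1+n b))

tally-delete : ∀ h h′ i n → i ≤ n → (∀ k → 1 ≤ k → k ≤ i → h k ≡ h′ k) → h (suc i) ≡ false →
               (∀ k → suc (suc i) ≤ k → k ≤ suc n → h k ≡ h′ (pred k)) → tally h (suc n) ≡ tally h′ n
tally-delete h h′ i n i≤n before at after with m≤n⇒m<n∨m≡n i≤n
... | inj₂ refl rewrite at = tally-cong h h′ i before
tally-delete h h′ i (suc n) _ before at after | inj₁ (s≤s i≤n) =
  cong₂ _+_ (cong b2n (after (suc (suc n)) (s≤s (s≤s i≤n)) ≤-refl))
            (tally-delete h h′ i n i≤n before at λ k a b → after k a (m≤n⇒m≤1+n b))

tally-threshold : ∀ h e n → (∀ k → 1 ≤ k → k ≤ n → (k ≤ e → h k ≡ true) × (e < k → h k ≡ false)) →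
                  tally h n ≡ n ⊓ e
tally-threshold h e zero    _ = refl
tally-threshold h e (suc n) f with suc n ≤? e
... | yes le rewrite proj₁ (f (suc n) (s≤s z≤n) ≤-refl) le
      | tally-threshold h e n (λ k a b → f k a (m≤n⇒m≤1+n b))
      | m≤n⇒m⊓n≡m le | m≤n⇒m⊓n≡m (<⇒≤ le) = refl
... | no nle rewrite proj₂ (f (suc n) (s≤s z≤n) ≤-refl) (≰⇒> nle)
      | tally-threshold h e n (λ k a b → f k a (m≤n⇒m≤1+n b))
      | m≥n⇒m⊓n≡n (<⇒≤ (≰⇒> nle)) | m≥n⇒m⊓n≡n (≤-pred (≰⇒> nle)) = refl

rotationBallot : List Letter → ℕ → Bool
rotationBallot w k = ballot 0 (BUps.rotate k w)

-- Cancelling a factor bUp rt* pUp in w deletes exactly one failing rotation.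
module Cancel (x r y : List Letter) (ar : AllRt r) where
  w w′ : List Letter
  w  = x ++ bUp ∷ r ++ pUp ∷ y
  w′ = x ++ r ++ y

  count-w : ∀ (q : Letter → Bool) → Marks.count q w ≡ b2n (q bUp) + b2n (q pUp) + Marks.count q w′
  count-w q
    rewrite Marks.count-++ q x (bUp ∷ r ++ pUp ∷ y) | Marks.count-++ q x (r ++ y)
          | Marks.count-++ q r (pUp ∷ y) | Marks.count-++ q r y
    = interchange (count x) (b2n (q bUp)) (count r) (b2n (q pUp)) (count y)
    where
      open Marks q using (count)
      interchange : ∀ a b c d e → a + (b + (c + (d + e))) ≡ b + d + (a + (c + e))
      interchange = solve-∀

  rotation-inside-x : ∀ k → k ≤ BUps.count x → rotationBallot w k ≡ rotationBallot w′ k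
  rotation-inside-x k le
    rewrite BUps.cut-++ˡ k x (bUp ∷ r ++ pUp ∷ y) le | BUps.cut-++ˡ k x (r ++ y) le = begin
      ballot 0 ((x₂ ++ bUp ∷ r ++ pUp ∷ y) ++ x₁)  ≡⟨ cong (ballot 0) (trans (++-assoc x₂ _ x₁)
                                                        (cong (λ z → x₂ ++ bUp ∷ z) (++-assoc r (pUp ∷ y) x₁))) ⟩
      ballot 0 (x₂ ++ bUp ∷ r ++ pUp ∷ y ++ x₁)    ≡⟨ ballot-cancel ar x₂ 0 (y ++ x₁) ⟩
      ballot 0 (x₂ ++ r ++ y ++ x₁)                ≡⟨ cong (ballot 0) (sym (trans (++-assoc x₂ (r ++ y) x₁)
                                                        (cong (x₂ ++_) (++-assoc r y x₁)))) ⟩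
      ballot 0 ((x₂ ++ r ++ y) ++ x₁)              ∎
    where
      open ≡-Reasoning
      x₁ = proj₁ (BUps.cut k x)
      x₂ = proj₂ (BUps.cut k x)

  -- The rotation starting right after the cancelled bUp begins with rt* pUp, so it fails.
  rotation-at-bUp : rotationBallot w (BUps.count x + 1) ≡ false
  rotation-at-bUp rewrite BUps.cut-++ʳ x 0 (bUp ∷ r ++ pUp ∷ y) | ++-assoc r (pUp ∷ y) (x ++ [ bUp ]) =
    ballot-skipRts ar 0 (pUp ∷ y ++ x ++ [ bUp ])

  rotation-inside-y : ∀ j → rotationBallot w (BUps.count x + suc (suc j))
                          ≡ rotationBallot w′ (BUps.count x + suc j)
  rotation-inside-y j
    rewrite BUps.cut-++ʳ x (suc j) (bUp ∷ r ++ pUp ∷ y) | BUps.cut-++ʳ x j (r ++ y)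
          | BUps.cut-unmarked-++ r j (pUp ∷ y) (AllRt-noBUp ar) | BUps.cut-unmarked-++ r j y (AllRt-noBUp ar) = begin
      ballot 0 (y₂ ++ x ++ bUp ∷ r ++ pUp ∷ y₁)    ≡⟨ cong (ballot 0) (sym (++-assoc y₂ x _)) ⟩
      ballot 0 ((y₂ ++ x) ++ bUp ∷ r ++ pUp ∷ y₁)  ≡⟨ ballot-cancel ar (y₂ ++ x) 0 y₁ ⟩
      ballot 0 ((y₂ ++ x) ++ r ++ y₁)              ≡⟨ cong (ballot 0) (++-assoc y₂ x (r ++ y₁)) ⟩
      ballot 0 (y₂ ++ x ++ r ++ y₁)                ∎
    where
      open ≡-Reasoning
      y₁ = proj₁ (BUps.cut (suc j) y)
      y₂ = proj₂ (BUps.cut (suc j) y)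

  tally-cancel : ∀ n → BUps.count w ≡ suc n → tally (rotationBallot w) (suc n) ≡ tally (rotationBallot w′) n
  tally-cancel n cw = tally-delete (rotationBallot w) (rotationBallot w′) (BUps.count x) n x≤n
    (λ k _ le → rotation-inside-x k le)
    (trans (cong (rotationBallot w) (+-comm 1 (BUps.count x))) rotation-at-bUp)
    after
    where
      x≤n : BUps.count x ≤ n
      x≤n = begin
        BUps.count x                       ≤⟨ m≤m+n (BUps.count x) (BUps.count (r ++ y)) ⟩
        BUps.count x + BUps.count (r ++ y) ≡⟨ sym (BUps.count-++ x (r ++ y)) ⟩
        BUps.count w′                      ≡⟨ suc-injective (trans (sym (count-w isBUp)) cw) ⟩
        n                                  ∎
        where open ≤-Reasoning
      after : ∀ k → suc (suc (BUps.count x)) ≤ k → k ≤ suc n → rotationBallot w k ≡ rotationBallot w′ (pred k)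
      after k le _ = subst (λ i → rotationBallot w i ≡ rotationBallot w′ (pred i)) k≡
        (trans (rotation-inside-y j) (cong (rotationBallot w′) (sym (cong pred (+-suc (BUps.count x) (suc j))))))
        where
          j = k ∸ suc (suc (BUps.count x))
          k≡ : BUps.count x + suc (suc j) ≡ k
          k≡ = trans (+-comm (BUps.count x) (suc (suc j)))
                 (trans (sym (+-suc (suc j) (BUps.count x))) (trans (sym (+-suc j _)) (m∸n+n≡m le)))

-- For a sorted word with m bUps and l ≤ m pUps, rotation k passes iff k ≤ m ∸ l:
-- the rotation puts m ∸ k bUps in front of the l pUps.
tally-sorted : ∀ u v l m → BUps.count u ≡ 0 → PUps.count v ≡ 0 →
               BUps.count (u ++ v) ≡ m → PUps.count (u ++ v) ≡ l → l ≤ m →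
               tally (rotationBallot (u ++ v)) m ≡ m ∸ l
tally-sorted u v l m cu cv cm cl l≤m =
  trans (tally-threshold (rotationBallot (u ++ v)) (m ∸ l) m threshold) (m≥n⇒m⊓n≡n (m∸n≤m m l))
  where
    bUps-v : BUps.count v ≡ m
    bUps-v = trans (sym (cong (_+ BUps.count v) cu)) (trans (sym (BUps.count-++ u v)) cm)
    pUps-u : PUps.count u ≡ l
    pUps-u = trans (sym (+-identityʳ (PUps.count u)))
               (trans (cong (PUps.count u +_) (sym cv)) (trans (sym (PUps.count-++ u v)) cl))
    threshold : ∀ k → 1 ≤ k → k ≤ m → (k ≤ m ∸ l → rotationBallot (u ++ v) k ≡ true)
                                    × (m ∸ l < k → rotationBallot (u ++ v) k ≡ false)
    threshold (suc k) _ k≤m = passes , fails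
      where
        v₁ = proj₁ (BUps.cut (suc k) v)
        v₂ = proj₂ (BUps.cut (suc k) v)
        v≡ : v₁ ++ v₂ ≡ v
        v≡ = BUps.cut-reassembles (suc k) v
        pUps-v₁₂ : PUps.count v₁ + PUps.count v₂ ≡ 0
        pUps-v₁₂ = trans (sym (PUps.count-++ v₁ v₂)) (trans (cong PUps.count v≡) cv)
        bUps-v₂ : BUps.count v₂ ≡ m ∸ suc k
        bUps-v₂ = trans (sym (m+n∸m≡n (BUps.count v₁) (BUps.count v₂)))
          (cong₂ _∸_ (trans (sym (BUps.count-++ v₁ v₂)) (trans (cong BUps.count v≡) bUps-v))
                     (BUps.count-cut (suc k) v (subst (suc k ≤_) (sym bUps-v) k≤m)))
        -- the rotation is v₂ ++ u ++ v₁, and v₂ only provides m ∸ (k+1) credits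
        rotation : rotationBallot (u ++ v) (suc k) ≡ ballot (m ∸ suc k) (u ++ v₁)
        rotation rewrite BUps.cut-unmarked-++ u k v cu =
          trans (ballot-noPUp v₂ (m+n≡0⇒n≡0 (PUps.count v₁) pUps-v₁₂) 0 (u ++ v₁))
                (cong (λ i → ballot i (u ++ v₁)) bUps-v₂)
        passes : suc k ≤ m ∸ l → rotationBallot (u ++ v) (suc k) ≡ true
        passes le = trans rotation (trans (ballot-noBUp-pass u cu (m ∸ suc k) v₁ enough)
                                          (ballot-noPUp-true v₁ (m+n≡0⇒m≡0 (PUps.count v₁) pUps-v₁₂) _))
          where
            enough : PUps.count u ≤ m ∸ suc k
            enough = subst (_≤ m ∸ suc k) (trans (m∸[m∸n]≡n l≤m) (sym pUps-u)) (∸-monoʳ-≤ m le)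
        fails : m ∸ l < suc k → rotationBallot (u ++ v) (suc k) ≡ false
        fails lt = trans rotation (ballot-noBUp-fail u cu (m ∸ suc k) v₁ short)
          where
            short : m ∸ suc k < PUps.count u
            short = subst (m ∸ suc k <_) (trans (m∸[m∸n]≡n l≤m) (sym pUps-u)) (∸-monoʳ-< lt k≤m)

-- Induction on l, cancelling factors bUp rt* pUp until the word is sorted.
cycle-lemma : ∀ l m w → BUps.count w ≡ m → PUps.count w ≡ l → l ≤ m → tally (rotationBallot w) m ≡ m ∸ l
cycle-lemma l m w cm cl l≤m with shape w
... | sorted u v cu cv refl = tally-sorted u v l m cu cv cm cl l≤m
cycle-lemma zero m w cm cl l≤m | cancellable x r y ar refl with trans (sym (Cancel.count-w x r y ar isPUp)) cl
... | ()
cycle-lemma (suc l) (suc m) w cm cl l≤m | cancellable x r y ar refl =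
  trans (Cancel.tally-cancel x r y ar m cm)
        (cycle-lemma l m (Cancel.w′ x r y ar) (suc-injective (trans (sym (Cancel.count-w x r y ar isBUp)) cm))
                     (suc-injective (trans (sym (Cancel.count-w x r y ar isPUp)) cl)) (≤-pred l≤m))

isU isR : Step → Bool
isU U = true
isU R = false
isR R = true
isR U = false

module Ups = Marks isU
module Rs  = Marks isR

pathPart boundaryPart : List Letter → List Step
pathPart []        = []
pathPart (bUp ∷ w) = pathPart w
pathPart (pUp ∷ w) = U ∷ pathPart w
pathPart (rt ∷ w)  = R ∷ pathPart w
boundaryPart []        = []
boundaryPart (bUp ∷ w) = U ∷ boundaryPart w
boundaryPart (pUp ∷ w) = boundaryPart w
boundaryPart (rt ∷ w)  = R ∷ boundaryPart w

pathPart-++ : ∀ u v → pathPart (u ++ v) ≡ pathPart u ++ pathPart v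
pathPart-++ []        v = refl
pathPart-++ (bUp ∷ u) v = pathPart-++ u v
pathPart-++ (pUp ∷ u) v = cong (U ∷_) (pathPart-++ u v)
pathPart-++ (rt ∷ u)  v = cong (R ∷_) (pathPart-++ u v)

boundaryPart-++ : ∀ u v → boundaryPart (u ++ v) ≡ boundaryPart u ++ boundaryPart v
boundaryPart-++ []        v = refl
boundaryPart-++ (bUp ∷ u) v = cong (U ∷_) (boundaryPart-++ u v)
boundaryPart-++ (pUp ∷ u) v = boundaryPart-++ u v
boundaryPart-++ (rt ∷ u)  v = cong (R ∷_) (boundaryPart-++ u v)

-- Interleave a path P and a boundary B with the same number of right steps, reading
-- them column by column: in each column the boundary's up steps come first, then the
-- path's, then the shared right step.
merge : List Step → List Step → List Letter
merge P       (U ∷ B) = bUp ∷ merge P B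
merge []      (R ∷ B) = rt ∷ merge [] B
merge []      []      = []
merge (U ∷ P) (R ∷ B) = pUp ∷ merge P (R ∷ B)
merge (R ∷ P) (R ∷ B) = rt ∷ merge P B
merge (U ∷ P) []      = pUp ∷ merge P []
merge (R ∷ P) []      = rt ∷ merge P []

pathPart-merge : ∀ P B → Rs.count P ≡ Rs.count B → pathPart (merge P B) ≡ P
pathPart-merge P       (U ∷ B) e = pathPart-merge P B e
pathPart-merge []      []      _ = refl
pathPart-merge (U ∷ P) (R ∷ B) e = cong (U ∷_) (pathPart-merge P (R ∷ B) e)
pathPart-merge (R ∷ P) (R ∷ B) e = cong (R ∷_) (pathPart-merge P B (suc-injective e))
pathPart-merge (U ∷ P) []      e = cong (U ∷_) (pathPart-merge P [] e)

boundaryPart-merge : ∀ P B → Rs.count P ≡ Rs.count B → boundaryPart (merge P B) ≡ B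
boundaryPart-merge P       (U ∷ B) e = cong (U ∷_) (boundaryPart-merge P B e)
boundaryPart-merge []      []      _ = refl
boundaryPart-merge (U ∷ P) (R ∷ B) e = boundaryPart-merge P (R ∷ B) e
boundaryPart-merge (R ∷ P) (R ∷ B) e = cong (R ∷_) (boundaryPart-merge P B (suc-injective e))
boundaryPart-merge (U ∷ P) []      e = boundaryPart-merge P [] e

bUps-merge : ∀ P B → BUps.count (merge P B) ≡ Ups.count B
bUps-merge P       (U ∷ B) = cong suc (bUps-merge P B)
bUps-merge []      (R ∷ B) = bUps-merge [] B
bUps-merge []      []      = refl
bUps-merge (U ∷ P) (R ∷ B) = bUps-merge P (R ∷ B)
bUps-merge (R ∷ P) (R ∷ B) = bUps-merge P B
bUps-merge (U ∷ P) []      = bUps-merge P []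
bUps-merge (R ∷ P) []      = bUps-merge P []

pUps-merge : ∀ P B → PUps.count (merge P B) ≡ Ups.count P
pUps-merge P       (U ∷ B) = pUps-merge P B
pUps-merge []      (R ∷ B) = pUps-merge [] B
pUps-merge []      []      = refl
pUps-merge (U ∷ P) (R ∷ B) = cong suc (pUps-merge P (R ∷ B))
pUps-merge (R ∷ P) (R ∷ B) = pUps-merge P B
pUps-merge (U ∷ P) []      = cong suc (pUps-merge P [])
pUps-merge (R ∷ P) []      = pUps-merge P []

Rs-pathPart : ∀ L → Rs.count (pathPart L) ≡ Rts.count L
Rs-pathPart []        = refl
Rs-pathPart (bUp ∷ L) = Rs-pathPart L
Rs-pathPart (pUp ∷ L) = Rs-pathPart L
Rs-pathPart (rt ∷ L)  = cong suc (Rs-pathPart L)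

Ups-pathPart : ∀ L → Ups.count (pathPart L) ≡ PUps.count L
Ups-pathPart []        = refl
Ups-pathPart (bUp ∷ L) = Ups-pathPart L
Ups-pathPart (pUp ∷ L) = cong suc (Ups-pathPart L)
Ups-pathPart (rt ∷ L)  = Ups-pathPart L

NotBUpFirst : List Letter → Set
NotBUpFirst (bUp ∷ _) = ⊥
NotBUpFirst _         = ⊤

Canonical : List Letter → Set
Canonical []        = ⊤
Canonical (bUp ∷ w) = Canonical w
Canonical (rt ∷ w)  = Canonical w
Canonical (pUp ∷ w) = NotBUpFirst w × Canonical w

merge-canonical : ∀ P B → Canonical (merge P B)
merge-canonical P       (U ∷ B) = merge-canonical P B
merge-canonical []      (R ∷ B) = merge-canonical [] B
merge-canonical []      []      = tt
merge-canonical (U ∷ P) (R ∷ B) = notBUpFirst P , merge-canonical P (R ∷ B)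
  where notBUpFirst : ∀ P → NotBUpFirst (merge P (R ∷ B))
        notBUpFirst []      = tt
        notBUpFirst (U ∷ _) = tt
        notBUpFirst (R ∷ _) = tt
merge-canonical (R ∷ P) (R ∷ B) = merge-canonical P B
merge-canonical (U ∷ P) []      = notBUpFirst P , merge-canonical P []
  where notBUpFirst : ∀ P → NotBUpFirst (merge P [])
        notBUpFirst []      = tt
        notBUpFirst (U ∷ _) = tt
        notBUpFirst (R ∷ _) = tt
merge-canonical (R ∷ P) []      = merge-canonical P []

merge-parts : ∀ L → Canonical L → merge (pathPart L) (boundaryPart L) ≡ L
merge-parts []        _       = refl
merge-parts (bUp ∷ L) c       = cong (bUp ∷_) (merge-parts L c)
merge-parts (rt ∷ L)  c       = cong (rt ∷_) (merge-parts L c)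
merge-parts (pUp ∷ L) (h , c) =
  trans (merge-pUp (boundaryPart L) (boundaryPart-head L h c)) (cong (pUp ∷_) (merge-parts L c))
  where
    NotUFirst : List Step → Set
    NotUFirst (U ∷ _) = ⊥
    NotUFirst _       = ⊤
    merge-pUp : ∀ {P} B → NotUFirst B → merge (U ∷ P) B ≡ pUp ∷ merge P B
    merge-pUp []      _ = refl
    merge-pUp (R ∷ B) _ = refl
    boundaryPart-head : ∀ L → NotBUpFirst L → Canonical L → NotUFirst (boundaryPart L)
    boundaryPart-head []        _ _       = tt
    boundaryPart-head (pUp ∷ L) _ (h , c) = boundaryPart-head L h c
    boundaryPart-head (rt ∷ L)  _ _       = tt

canonical-++ˡ : ∀ u v → Canonical (u ++ v) → Canonical u
canonical-++ˡ []        v _       = tt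
canonical-++ˡ (bUp ∷ u) v c       = canonical-++ˡ u v c
canonical-++ˡ (rt ∷ u)  v c       = canonical-++ˡ u v c
canonical-++ˡ (pUp ∷ u) v (h , c) = notBUpFirst u h , canonical-++ˡ u v c
  where notBUpFirst : ∀ u → NotBUpFirst (u ++ v) → NotBUpFirst u
        notBUpFirst []        _ = tt
        notBUpFirst (pUp ∷ _) _ = tt
        notBUpFirst (rt ∷ _)  _ = tt

canonical-++ʳ : ∀ u v → Canonical (u ++ v) → Canonical v
canonical-++ʳ []        v c       = c
canonical-++ʳ (bUp ∷ u) v c       = canonical-++ʳ u v c
canonical-++ʳ (rt ∷ u)  v c       = canonical-++ʳ u v c
canonical-++ʳ (pUp ∷ u) v (_ , c) = canonical-++ʳ u v c

canonical-join : ∀ u v → Canonical (u ++ [ bUp ]) → Canonical v → Canonical (u ++ bUp ∷ v)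
canonical-join []        v _       cv = cv
canonical-join (bUp ∷ u) v cu      cv = canonical-join u v cu cv
canonical-join (rt ∷ u)  v cu      cv = canonical-join u v cu cv
canonical-join (pUp ∷ u) v (h , cu) cv = notBUpFirst u h , canonical-join u v cu cv
  where notBUpFirst : ∀ u → NotBUpFirst (u ++ [ bUp ]) → NotBUpFirst (u ++ bUp ∷ v)
        notBUpFirst []        ()
        notBUpFirst (pUp ∷ _) _ = tt
        notBUpFirst (rt ∷ _)  _ = tt

-- Just before a bUp, the path part of a canonical word is empty or ends with R
-- (it cannot end with U, since that pUp would be followed by a bUp).
EndsR : List Step → Set
EndsR Z = Σ (List Step) λ Z′ → Z ≡ Z′ ++ [ R ]

pathPart-before-bUp : ∀ w t → Canonical (w ++ bUp ∷ t) → pathPart w ≡ [] ⊎ EndsR (pathPart w)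
pathPart-before-bUp []        t _ = inj₁ refl
pathPart-before-bUp (bUp ∷ w) t c = pathPart-before-bUp w t c
pathPart-before-bUp (rt ∷ w)  t c with pathPart-before-bUp w t c
... | inj₁ e       = inj₂ ([] , cong (R ∷_) e)
... | inj₂ (Z , e) = inj₂ (R ∷ Z , cong (R ∷_) e)
pathPart-before-bUp (pUp ∷ w) t (h , c) with pathPart-before-bUp w t c
... | inj₁ e       = ⊥-elim (noPath w e h)
  where noPath : ∀ w → pathPart w ≡ [] → NotBUpFirst (w ++ bUp ∷ t) → ⊥
        noPath []        _ ()
        noPath (bUp ∷ w) _ ()
... | inj₂ (Z , e) = inj₂ (U ∷ Z , cong (U ∷_) e)

WellMerged : List Letter → Set
WellMerged L = Canonical L × BUps.EndsMarked L × EndsR (pathPart L)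

ends-with-bUp : ∀ {w} (e : BUps.EndsMarked w) → w ≡ proj₁ e ++ [ bUp ]
ends-with-bUp (_ , bUp , e , _) = e

canonical-swap : ∀ x y → Canonical (x ++ y) → y ≡ [] ⊎ BUps.EndsMarked y → Canonical (y ++ x)
canonical-swap x y cxy (inj₁ y≡) = subst (λ z → Canonical (z ++ x)) (sym y≡) (canonical-++ˡ x y cxy)
canonical-swap x y cxy (inj₂ ey) = subst (λ z → Canonical (z ++ x)) (sym y≡)
  (subst Canonical (sym (++-assoc y′ [ bUp ] x))
         (canonical-join y′ x (subst Canonical y≡ (canonical-++ʳ x y cxy)) (canonical-++ˡ x y cxy)))
  where y′ = proj₁ ey
        y≡ = ends-with-bUp ey

-- Exchanging the factors x′ bUp and y: the path part still ends with R.  Either the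
-- path part of x′ ends with R, or it is empty and the path part is unchanged.
pathEnds-swap : ∀ x′ y → Canonical (x′ ++ [ bUp ]) → EndsR (pathPart ((x′ ++ [ bUp ]) ++ y)) →
                EndsR (pathPart (y ++ x′ ++ [ bUp ]))
pathEnds-swap x′ y cx (Z , pL) with pathPart-before-bUp x′ [] cx
... | inj₂ (Z′ , e) = pathPart y ++ Z′ , (begin
  pathPart (y ++ x′ ++ [ bUp ])      ≡⟨ pathPart-++ y (x′ ++ [ bUp ]) ⟩
  pathPart y ++ pathPart (x′ ++ [ bUp ]) ≡⟨ cong (pathPart y ++_) (trans pathPart-x e) ⟩
  pathPart y ++ Z′ ++ [ R ]          ≡⟨ sym (++-assoc (pathPart y) Z′ [ R ]) ⟩
  (pathPart y ++ Z′) ++ [ R ]        ∎)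
  where open ≡-Reasoning
        pathPart-x = trans (pathPart-++ x′ [ bUp ]) (++-identityʳ (pathPart x′))
... | inj₁ e = Z , (begin
  pathPart (y ++ x′ ++ [ bUp ])      ≡⟨ pathPart-++ y (x′ ++ [ bUp ]) ⟩
  pathPart y ++ pathPart (x′ ++ [ bUp ]) ≡⟨ cong (pathPart y ++_) x-empty ⟩
  pathPart y ++ []                   ≡⟨ ++-identityʳ (pathPart y) ⟩
  pathPart y                         ≡⟨ cong (_++ pathPart y) (sym x-empty) ⟩
  pathPart (x′ ++ [ bUp ]) ++ pathPart y ≡⟨ sym (pathPart-++ (x′ ++ [ bUp ]) y) ⟩
  pathPart ((x′ ++ [ bUp ]) ++ y)    ≡⟨ pL ⟩
  Z ++ [ R ]                         ∎)
  where open ≡-Reasoning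
        x-empty = trans (trans (pathPart-++ x′ [ bUp ]) (++-identityʳ (pathPart x′))) e

rotate-WellMerged : ∀ k L → k ≤ BUps.count L → WellMerged L → WellMerged (BUps.rotate k L)
rotate-WellMerged zero    L _  wm rewrite ++-identityʳ L = wm
rotate-WellMerged (suc k) L le (cL , eL , pL) =
    canonical-swap x y cxy (BUps.suffix-EndsMarked x y (subst BUps.EndsMarked (sym xy) eL))
  , (y ++ x′ , bUp , trans (cong (y ++_) x≡) (sym (++-assoc y x′ [ bUp ])) , refl)
  , subst (λ z → EndsR (pathPart (y ++ z))) (sym x≡)
          (pathEnds-swap x′ y (subst Canonical x≡ (canonical-++ˡ x y cxy))
                         (subst (λ z → EndsR (pathPart (z ++ y))) x≡ (subst (EndsR ∘ pathPart) (sym xy) pL)))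
  where
    x = proj₁ (BUps.cut (suc k) L)
    y = proj₂ (BUps.cut (suc k) L)
    xy : x ++ y ≡ L
    xy = BUps.cut-reassembles (suc k) L
    cxy : Canonical (x ++ y)
    cxy = subst Canonical (sym xy) cL
    ex = BUps.cut-EndsMarked k L le
    x′ = proj₁ ex
    x≡ : x ≡ x′ ++ [ bUp ]
    x≡ = ends-with-bUp ex

boundaryPart-cut : ∀ k L → Ups.cut k (boundaryPart L)
                         ≡ (boundaryPart (proj₁ (BUps.cut k L)) , boundaryPart (proj₂ (BUps.cut k L)))
boundaryPart-cut zero    L         = refl
boundaryPart-cut (suc k) []        = refl
boundaryPart-cut (suc k) (bUp ∷ L) rewrite boundaryPart-cut k L = refl
boundaryPart-cut (suc k) (pUp ∷ L) rewrite boundaryPart-cut (suc k) L = refl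
boundaryPart-cut (suc k) (rt ∷ L)  rewrite boundaryPart-cut (suc k) L = refl

boundaryPart-rotate : ∀ k L → boundaryPart (BUps.rotate k L) ≡ Ups.rotate k (boundaryPart L)
boundaryPart-rotate k L rewrite boundaryPart-cut k L =
  boundaryPart-++ (proj₂ (BUps.cut k L)) (proj₁ (BUps.cut k L))

dropLast : List Step → List Step
dropLast []           = []
dropLast (_ ∷ [])     = []
dropLast (x ∷ y ∷ xs) = x ∷ dropLast (y ∷ xs)

dropLast-∷ʳ : ∀ Z c → dropLast (Z ++ [ c ]) ≡ Z
dropLast-∷ʳ []           c = refl
dropLast-∷ʳ (x ∷ [])     c = refl
dropLast-∷ʳ (x ∷ y ∷ Z) c = cong (x ∷_) (dropLast-∷ʳ (y ∷ Z) c)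

Rs-∷ʳR : ∀ Q → Rs.count (Q ++ [ R ]) ≡ suc (Rs.count Q)
Rs-∷ʳR Q = trans (Rs.count-++ Q [ R ]) (+-comm (Rs.count Q) 1)

Ups-∷ʳR : ∀ Q → Ups.count (Q ++ [ R ]) ≡ Ups.count Q
Ups-∷ʳR Q = trans (Ups.count-++ Q [ R ]) (+-identityʳ (Ups.count Q))

pathOf : List Letter → List Step
pathOf L = dropLast (pathPart L)

pathOf-∷ʳR : ∀ L → EndsR (pathPart L) → pathOf L ++ [ R ] ≡ pathPart L
pathOf-∷ʳR L (Z , e) rewrite e = cong (_++ [ R ]) (dropLast-∷ʳ Z R)

merge-pathOf : ∀ L → WellMerged L → merge (pathOf L ++ [ R ]) (boundaryPart L) ≡ L
merge-pathOf L (c , _ , e) = trans (cong (λ P → merge P (boundaryPart L)) (pathOf-∷ʳR L e)) (merge-parts L c)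

Rs-pathOf : ∀ L → WellMerged L → suc (Rs.count (pathOf L)) ≡ Rts.count L
Rs-pathOf L (_ , _ , e) =
  trans (sym (Rs-∷ʳR (pathOf L))) (trans (cong Rs.count (pathOf-∷ʳR L e)) (Rs-pathPart L))

Ups-pathOf : ∀ L → WellMerged L → Ups.count (pathOf L) ≡ PUps.count L
Ups-pathOf L (_ , _ , e) =
  trans (sym (Ups-∷ʳR (pathOf L))) (trans (cong Ups.count (pathOf-∷ʳR L e)) (Ups-pathPart L))

ends-bUp : ∀ L Z B′ → pathPart L ≡ Z ++ [ R ] → boundaryPart L ≡ B′ ++ [ U ] → BUps.EndsMarked L
ends-bUp L Z B′ pL bL with initLast L
ends-bUp .[] (_ ∷ _) B′ () bL | []
ends-bUp .[] [] B′ () bL | []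
ends-bUp .(L′ ∷ʳ bUp) Z B′ pL bL | L′ ∷ʳ′ bUp = L′ , bUp , refl , refl
ends-bUp .(L′ ∷ʳ pUp) Z B′ pL bL | L′ ∷ʳ′ pUp
  with ∷ʳ-injective (pathPart L′) Z (trans (sym (pathPart-++ L′ [ pUp ])) pL)
... | _ , ()
ends-bUp .(L′ ∷ʳ rt) Z B′ pL bL | L′ ∷ʳ′ rt
  with ∷ʳ-injective (boundaryPart L′) B′ (trans (sym (boundaryPart-++ L′ [ rt ])) bL)
... | _ , ()

Paths : ℕ → ℕ → Set
Paths n l = Σ (List Step) λ Q → (Rs.count Q ≡ n) × (Ups.count Q ≡ l)

Paths-≡ : ∀ {n l} {Q Q′ : Paths n l} → proj₁ Q ≡ proj₁ Q′ → Q ≡ Q′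
Paths-≡ {Q = Q , r , u} {.Q , r′ , u′} refl = cong₂ (λ r u → Q , r , u) (≡-irrelevant r r′) (≡-irrelevant u u′)

BoundaryWord : ℕ → ℕ → List Step → Set
BoundaryWord m n B = (Ups.count B ≡ m) × (Rs.count B ≡ suc n) × Ups.EndsMarked B

merged : List Step → List Step → List Letter
merged B Q = merge (Q ++ [ R ]) B

rotatePath : ℕ → List Step → List Step → List Step
rotatePath k B Q = pathOf (BUps.rotate k (merged B Q))

module RotatePaths {m n : ℕ} {B : List Step} (bw : BoundaryWord m n B)
                   {Q : List Step} (rQ : Rs.count Q ≡ n) where

  L = merged B Q

  equalRights : Rs.count (Q ++ [ R ]) ≡ Rs.count B
  equalRights = trans (Rs-∷ʳR Q) (trans (cong suc rQ) (sym (proj₁ (proj₂ bw))))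

  bUps-L : BUps.count L ≡ m
  bUps-L = trans (bUps-merge (Q ++ [ R ]) B) (proj₁ bw)

  pUps-L : PUps.count L ≡ Ups.count Q
  pUps-L = trans (pUps-merge (Q ++ [ R ]) B) (Ups-∷ʳR Q)

  rts-L : Rts.count L ≡ suc n
  rts-L = trans (sym (Rs-pathPart L))
                (trans (cong Rs.count (pathPart-merge _ B equalRights)) (trans (Rs-∷ʳR Q) (cong suc rQ)))

  pathOf-L : pathOf L ≡ Q
  pathOf-L = trans (cong dropLast (pathPart-merge (Q ++ [ R ]) B equalRights)) (dropLast-∷ʳ Q R)

  L-WellMerged : WellMerged L
  L-WellMerged = merge-canonical (Q ++ [ R ]) B
               , ends-bUp L Q _ (pathPart-merge _ B equalRights)
                          (trans (boundaryPart-merge _ B equalRights) (endsU (proj₂ (proj₂ bw))))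
               , Q , pathPart-merge _ B equalRights
    where
      endsU : ∀ {B} (e : Ups.EndsMarked B) → B ≡ proj₁ e ++ [ U ]
      endsU (_ , U , e , _) = e

  module _ (k : ℕ) (k≤m : k ≤ m) where
    L′ = BUps.rotate k L

    L′-WellMerged : WellMerged L′
    L′-WellMerged = rotate-WellMerged k L (subst (k ≤_) (sym bUps-L) k≤m) L-WellMerged

    merged-rotatePath : merged (Ups.rotate k B) (rotatePath k B Q) ≡ L′
    merged-rotatePath = begin
      merge (pathOf L′ ++ [ R ]) (Ups.rotate k B)
        ≡⟨ cong (merge _) (sym (trans (boundaryPart-rotate k L)
                                      (cong (Ups.rotate k) (boundaryPart-merge _ B equalRights)))) ⟩
      merge (pathOf L′ ++ [ R ]) (boundaryPart L′)
        ≡⟨ merge-pathOf L′ L′-WellMerged ⟩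
      L′ ∎
      where open ≡-Reasoning

    Rs-rotatePath : Rs.count (rotatePath k B Q) ≡ n
    Rs-rotatePath = suc-injective (trans (Rs-pathOf L′ L′-WellMerged) (trans (count-rotate isBUp isRt k L) rts-L))

    Ups-rotatePath : Ups.count (rotatePath k B Q) ≡ Ups.count Q
    Ups-rotatePath = trans (Ups-pathOf L′ L′-WellMerged) (trans (count-rotate isBUp isPUp k L) pUps-L)

    rotate-back : BUps.rotate (m ∸ k) (merged (Ups.rotate k B) (rotatePath k B Q)) ≡ L
    rotate-back = trans (cong (BUps.rotate (m ∸ k)) merged-rotatePath)
                        (BUps.rotate-inverse m k L bUps-L k≤m (proj₁ (proj₂ L-WellMerged)))

    rotatePath-inverse : rotatePath (m ∸ k) (Ups.rotate k B) (rotatePath k B Q) ≡ Q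
    rotatePath-inverse = trans (cong pathOf rotate-back) pathOf-L

boundaryOf : List ℕ → List Step
boundaryOf []       = []
boundaryOf (v ∷ vs) = replicate v R ++ U ∷ boundaryOf vs

boundary : ∀ {m} → (Fin m → ℕ) → List Step
boundary c = boundaryOf (tabulate c)

boundaryOf-++ : ∀ xs ys → boundaryOf (xs ++ ys) ≡ boundaryOf xs ++ boundaryOf ys
boundaryOf-++ []       ys = refl
boundaryOf-++ (v ∷ xs) ys rewrite boundaryOf-++ xs ys =
  sym (++-assoc (replicate v R) (U ∷ boundaryOf xs) (boundaryOf ys))

Ups-replicateR : ∀ v → Ups.count (replicate v R) ≡ 0
Ups-replicateR zero    = refl
Ups-replicateR (suc v) = Ups-replicateR v

Rs-replicateR : ∀ v → Rs.count (replicate v R) ≡ v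
Rs-replicateR zero    = refl
Rs-replicateR (suc v) = cong suc (Rs-replicateR v)

cut-boundaryOf : ∀ xs ys → Ups.cut (length xs) (boundaryOf (xs ++ ys)) ≡ (boundaryOf xs , boundaryOf ys)
cut-boundaryOf []       ys = refl
cut-boundaryOf (v ∷ xs) ys
  rewrite Ups.cut-unmarked-++ (replicate v R) (length xs) (U ∷ boundaryOf (xs ++ ys)) (Ups-replicateR v)
        | cut-boundaryOf xs ys = refl

rotate-boundaryOf : ∀ xs ys → Ups.rotate (length xs) (boundaryOf (xs ++ ys)) ≡ boundaryOf (ys ++ xs)
rotate-boundaryOf xs ys rewrite cut-boundaryOf xs ys = sym (boundaryOf-++ ys xs)

Ups-boundary : ∀ {m} (c : Fin m → ℕ) → Ups.count (boundary c) ≡ m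
Ups-boundary {zero}  c = refl
Ups-boundary {suc m} c rewrite Ups.count-++ (replicate (c fzero) R) (U ∷ boundary (c ∘ fsuc)) | Ups-replicateR (c fzero) =
  cong suc (Ups-boundary (c ∘ fsuc))

Rs-boundary : ∀ {m} (c : Fin m → ℕ) → Rs.count (boundary c) ≡ total c
Rs-boundary {zero}  c = refl
Rs-boundary {suc m} c rewrite Rs.count-++ (replicate (c fzero) R) (U ∷ boundary (c ∘ fsuc)) | Rs-replicateR (c fzero) =
  cong (c fzero +_) (Rs-boundary (c ∘ fsuc))

boundary-ends : ∀ {m} (c : Fin (suc m) → ℕ) → Ups.EndsMarked (boundary c)
boundary-ends {zero}  c = replicate (c fzero) R , U , refl , refl
boundary-ends {suc m} c with boundary-ends (c ∘ fsuc)
... | w′ , d , e , pd = replicate (c fzero) R ++ U ∷ w′ , d ,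
      trans (cong (λ z → replicate (c fzero) R ++ U ∷ z) e) (sym (++-assoc (replicate (c fzero) R) (U ∷ w′) [ d ])) , pd

-- boundaryX B t: the number of right steps of B before its t-th up step, i.e. the
-- x-coordinate at which B reaches height t.
boundaryX : List Step → ℕ → ℕ
boundaryX B       zero    = 0
boundaryX []      (suc t) = 0
boundaryX (U ∷ B) (suc t) = boundaryX B t
boundaryX (R ∷ B) (suc t) = suc (boundaryX B (suc t))

boundaryX-[] : ∀ t → boundaryX [] t ≡ 0
boundaryX-[] zero    = refl
boundaryX-[] (suc t) = refl

psum-boundaryX : ∀ {m} (c : Fin m → ℕ) y → psum c y ≡ boundaryX (boundary c) y
psum-boundaryX {zero}  c zero    = refl
psum-boundaryX {zero}  c (suc y) = refl
psum-boundaryX {suc m} c zero    = refl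
psum-boundaryX {suc m} c (suc y) = trans (cong (c fzero +_) (psum-boundaryX (c ∘ fsuc) y)) (sym (replicate-R (c fzero)))
  where
    replicate-R : ∀ v → boundaryX (replicate v R ++ U ∷ boundary (c ∘ fsuc)) (suc y)
                      ≡ v + boundaryX (boundary (c ∘ fsuc)) y
    replicate-R zero    = refl
    replicate-R (suc v) = cong suc (replicate-R v)

DomAt : List Step → ℕ → ℕ → Set
DomAt B t x = (t ≤ Ups.count B) × (boundaryX B t ≤ x)

DominatedFrom : ℕ → List Step → ℕ × ℕ → Set
DominatedFrom d B (x , y) = DomAt B (y ∸ d) x

DomAt-U⇒ : ∀ B t x → DomAt (U ∷ B) t x → DomAt B (pred t) x
DomAt-U⇒ B zero    x _          = z≤n , z≤n
DomAt-U⇒ B (suc t) x (s≤s a , b) = a , b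

DomAt-U⇐ : ∀ B t x → DomAt B (pred t) x → DomAt (U ∷ B) t x
DomAt-U⇐ B zero    x _       = z≤n , z≤n
DomAt-U⇐ B (suc t) x (a , b) = s≤s a , b

DominatedFrom-U⇒ : ∀ d B p → DominatedFrom d (U ∷ B) p → DominatedFrom (suc d) B p
DominatedFrom-U⇒ d B (x , y) c = subst (λ t → DomAt B t x) (pred[m∸n]≡m∸[1+n] y d) (DomAt-U⇒ B (y ∸ d) x c)

DominatedFrom-U⇐ : ∀ d B p → DominatedFrom (suc d) B p → DominatedFrom d (U ∷ B) p
DominatedFrom-U⇐ d B (x , y) c = DomAt-U⇐ B (y ∸ d) x (subst (λ t → DomAt B t x) (sym (pred[m∸n]≡m∸[1+n] y d)) c)

DomAt-R⇒ : ∀ B t x → DomAt (R ∷ B) t (suc x) → DomAt B t x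
DomAt-R⇒ B zero    x (a , _)     = a , z≤n
DomAt-R⇒ B (suc t) x (a , s≤s b) = a , b

DomAt-R⇐ : ∀ B t x → DomAt B t x → DomAt (R ∷ B) t (suc x)
DomAt-R⇐ B zero    x (a , _) = a , z≤n
DomAt-R⇐ B (suc t) x (a , b) = a , s≤s b

DomAt-[]⇒ : ∀ t x → DomAt [] t (suc x) → DomAt [] t x
DomAt-[]⇒ t x (a , _) = a , subst (_≤ x) (sym (boundaryX-[] t)) z≤n

DomAt-[]⇐ : ∀ t x → DomAt [] t x → DomAt [] t (suc x)
DomAt-[]⇐ t x (a , _) = a , subst (_≤ suc x) (sym (boundaryX-[] t)) z≤n

origin-dominated : ∀ d B → DominatedFrom d B (0 , 0)
origin-dominated d B rewrite 0∸n≡0 d = z≤n , z≤n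

PathDominatedFrom : ℕ → List Step → List Step → Set
PathDominatedFrom d B P = All (DominatedFrom d B) (points P)

points-R : ∀ x y P → pointsFrom (suc x , y) P ≡ map (λ { (x , y) → suc x , y }) (pointsFrom (x , y) P)
points-R x y []      = refl
points-R x y (U ∷ P) = cong ((suc x , y) ∷_) (points-R x (suc y) P)
points-R x y (R ∷ P) = cong ((suc x , y) ∷_) (points-R (suc x) y P)

points-U : ∀ x y P → pointsFrom (x , suc y) P ≡ map (λ { (x , y) → x , suc y }) (pointsFrom (x , y) P)
points-U x y []      = refl
points-U x y (U ∷ P) = cong ((x , suc y) ∷_) (points-U x (suc y) P)
points-U x y (R ∷ P) = cong ((x , suc y) ∷_) (points-U (suc x) y P)

module _ {Q : ℕ × ℕ → Set} where
  All-points-U⇒ : ∀ P → All Q (points (U ∷ P)) → All (λ { (x , y) → Q (x , suc y) }) (points P)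
  All-points-U⇒ P (_ ∷ a) = map⁻ (subst (All _) (points-U 0 0 P) a)

  All-points-R⇒ : ∀ P → All Q (points (R ∷ P)) → All (λ { (x , y) → Q (suc x , y) }) (points P)
  All-points-R⇒ P (_ ∷ a) = map⁻ (subst (All _) (points-R 0 0 P) a)

  All-points-U⇐ : ∀ P → Q (0 , 0) → All (λ { (x , y) → Q (x , suc y) }) (points P) → All Q (points (U ∷ P))
  All-points-U⇐ P q a = q ∷ subst (All _) (sym (points-U 0 0 P)) (map⁺ a)

  All-points-R⇐ : ∀ P → Q (0 , 0) → All (λ { (x , y) → Q (suc x , y) }) (points P) → All Q (points (R ∷ P))
  All-points-R⇐ P q a = q ∷ subst (All _) (sym (points-R 0 0 P)) (map⁺ a)

  second-point-U : ∀ P → All Q (points (U ∷ P)) → Q (0 , 1)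
  second-point-U []      (_ ∷ q ∷ _) = q
  second-point-U (U ∷ P) (_ ∷ q ∷ _) = q
  second-point-U (R ∷ P) (_ ∷ q ∷ _) = q

-- The path P is dominated by the boundary B drawn from (0 , d) iff the merged word
-- passes the ballot condition with initial credit d (d = boundary height − path height).
dominated⇒ballot : ∀ d B P → PathDominatedFrom d B P → T (ballot d (merge P B))
dominated⇒ballot d       (U ∷ B) P       dom = dominated⇒ballot (suc d) B P (All-map (DominatedFrom-U⇒ d B _) dom)
dominated⇒ballot d       (R ∷ B) []      _   rewrite ballot-noPUp-true (merge [] B) (pUps-merge [] B) d = tt
dominated⇒ballot d       []      []      _   = tt
dominated⇒ballot zero    (R ∷ B) (U ∷ P) dom with second-point-U P dom
... | _ , ()
dominated⇒ballot (suc d) (R ∷ B) (U ∷ P) dom = dominated⇒ballot d (R ∷ B) P (All-points-U⇒ P dom)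
dominated⇒ballot d       (R ∷ B) (R ∷ P) dom =
  dominated⇒ballot d B P (All-map (λ {p} → DomAt-R⇒ B (proj₂ p ∸ d) (proj₁ p)) (All-points-R⇒ P dom))
dominated⇒ballot zero    []      (U ∷ P) dom with second-point-U P dom
... | () , _
dominated⇒ballot (suc d) []      (U ∷ P) dom = dominated⇒ballot d [] P (All-points-U⇒ P dom)
dominated⇒ballot d       []      (R ∷ P) dom =
  dominated⇒ballot d [] P (All-map (λ {p} → DomAt-[]⇒ (proj₂ p ∸ d) (proj₁ p)) (All-points-R⇒ P dom))

ballot⇒dominated : ∀ d B P → T (ballot d (merge P B)) → PathDominatedFrom d B P
ballot⇒dominated d       (U ∷ B) P       t = All-map (DominatedFrom-U⇐ d B _) (ballot⇒dominated (suc d) B P t)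
ballot⇒dominated d       (R ∷ B) []      _ = origin-dominated d (R ∷ B) ∷ []
ballot⇒dominated d       []      []      _ = origin-dominated d [] ∷ []
ballot⇒dominated (suc d) (R ∷ B) (U ∷ P) t =
  All-points-U⇐ P (origin-dominated (suc d) (R ∷ B)) (ballot⇒dominated d (R ∷ B) P t)
ballot⇒dominated d       (R ∷ B) (R ∷ P) t =
  All-points-R⇐ P (origin-dominated d (R ∷ B))
    (All-map (λ {p} → DomAt-R⇐ B (proj₂ p ∸ d) (proj₁ p)) (ballot⇒dominated d B P t))
ballot⇒dominated (suc d) []      (U ∷ P) t = All-points-U⇐ P (origin-dominated (suc d) []) (ballot⇒dominated d [] P t)
ballot⇒dominated d       []      (R ∷ P) t =
  All-points-R⇐ P (origin-dominated d [])
    (All-map (λ {p} → DomAt-[]⇐ (proj₂ p ∸ d) (proj₁ p)) (ballot⇒dominated d [] P t))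

dominated⇒ballot₀ : ∀ {m} (c : Fin m → ℕ) P → Dominated c P → T (ballot 0 (merge P (boundary c)))
dominated⇒ballot₀ c P dom = dominated⇒ballot 0 (boundary c) P (All-map toBoundary dom)
  where
    toBoundary : ∀ {p} → DominatedPt c p → DominatedFrom 0 (boundary c) p
    toBoundary {x , y} (a , b) = subst (y ≤_) (sym (Ups-boundary c)) a , subst (_≤ x) (psum-boundaryX c y) b

ballot⇒dominated₀ : ∀ {m} (c : Fin m → ℕ) P → T (ballot 0 (merge P (boundary c))) → Dominated c P
ballot⇒dominated₀ c P t = All-map fromBoundary (ballot⇒dominated 0 (boundary c) P t)
  where
    fromBoundary : ∀ {p} → DominatedFrom 0 (boundary c) p → DominatedPt c p
    fromBoundary {x , y} (a , b) = subst (y ≤_) (Ups-boundary c) a , subst (_≤ x) (sym (psum-boundaryX c y)) b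

tabulate-applyUpTo : ∀ {m} (c : Fin m → ℕ) (g : ℕ → ℕ) → (∀ i → c i ≡ g (toℕ i)) →
                     tabulate c ≡ applyUpTo g m
tabulate-applyUpTo {zero}  c g eq = refl
tabulate-applyUpTo {suc m} c g eq = cong₂ _∷_ (eq fzero) (tabulate-applyUpTo (c ∘ fsuc) (g ∘ suc) (eq ∘ fsuc))

applyUpTo-cong : ∀ {g h : ℕ → ℕ} n → (∀ i → g i ≡ h i) → applyUpTo g n ≡ applyUpTo h n
applyUpTo-cong zero    eq = refl
applyUpTo-cong (suc n) eq = cong₂ _∷_ (eq 0) (applyUpTo-cong n (eq ∘ suc))

applyUpTo-+ : ∀ (g : ℕ → ℕ) p q → applyUpTo g (p + q) ≡ applyUpTo g p ++ applyUpTo (λ i → g (p + i)) q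
applyUpTo-+ g zero    q = refl
applyUpTo-+ g (suc p) q = cong (g 0 ∷_) (applyUpTo-+ (g ∘ suc) p q)

-- The boundary of the cyclic shift a^j, rotated after its first j up steps, is the
-- boundary of a: the shift moves the last j parts of a to the front.
rotate-boundary-shift : ∀ {m′} (a : Fin (suc m′) → ℕ) (j : Fin (suc m′)) →
                        Ups.rotate (toℕ j) (boundary (shift a j)) ≡ boundary a
rotate-boundary-shift {m′} a j = begin
  Ups.rotate k (boundary (shift a j))             ≡⟨ cong (λ B → Ups.rotate k (boundaryOf B)) shifted≡ ⟩
  Ups.rotate k (boundaryOf (xs ++ ys))
    ≡⟨ cong (λ i → Ups.rotate i (boundaryOf (xs ++ ys))) (sym (length-applyUpTo _ k)) ⟩
  Ups.rotate (length xs) (boundaryOf (xs ++ ys))  ≡⟨ rotate-boundaryOf xs ys ⟩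
  boundaryOf (ys ++ xs)                           ≡⟨ cong boundaryOf (sym original≡) ⟩
  boundary a                                      ∎
  where
    open ≡-Reasoning
    m = suc m′
    k = toℕ j
    s = m ∸ k
    k+s≡m : k + s ≡ m
    k+s≡m = m+[n∸m]≡n (<⇒≤ (toℕ<n j))
    A : ℕ → ℕ
    A i = a (i mod m)
    A-periodic : ∀ i → A (i + m) ≡ A i
    A-periodic i = cong a (fromℕ<-cong _ _ ([m+n]%n≡m%n i m) (m%n<n (i + m) m) (m%n<n i m))
    xs = applyUpTo (λ i → A (s + i)) k
    ys = applyUpTo A s
    shifted≡ : tabulate (shift a j) ≡ xs ++ ys
    shifted≡ = begin
      tabulate (shift a j)
        ≡⟨ tabulate-applyUpTo (shift a j) (λ i → A (i + s)) (λ _ → refl) ⟩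
      applyUpTo (λ i → A (i + s)) m        ≡⟨ cong (applyUpTo (λ i → A (i + s))) (sym k+s≡m) ⟩
      applyUpTo (λ i → A (i + s)) (k + s)  ≡⟨ applyUpTo-+ (λ i → A (i + s)) k s ⟩
      applyUpTo (λ i → A (i + s)) k ++ applyUpTo (λ i → A (k + i + s)) s
        ≡⟨ cong₂ _++_ (applyUpTo-cong k (λ i → cong A (+-comm i s))) (applyUpTo-cong s wrap) ⟩
      xs ++ ys ∎
      where
        wrap : ∀ i → A (k + i + s) ≡ A i
        wrap i = trans (cong A (trans (cong (_+ s) (+-comm k i)) (trans (+-assoc i k s) (cong (i +_) k+s≡m))))
                       (A-periodic i)
    original≡ : tabulate a ≡ ys ++ xs
    original≡ = begin
      tabulate a              ≡⟨ tabulate-applyUpTo a A (λ i → cong a (sym (mod-toℕ i))) ⟩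
      applyUpTo A m           ≡⟨ cong (applyUpTo A) (sym (m∸n+n≡m (<⇒≤ (toℕ<n j)))) ⟩
      applyUpTo A (s + k)     ≡⟨ applyUpTo-+ A s k ⟩
      ys ++ xs                ∎
      where
        mod-toℕ : ∀ i → toℕ i mod m ≡ i
        mod-toℕ i = trans (fromℕ<-cong _ _ (m<n⇒m%n≡m (toℕ<n i)) (m%n<n (toℕ i) m) (toℕ<n i))
                          (fromℕ<-toℕ i (toℕ<n i))

Fin-cong : ∀ {a b} → a ≡ b → Fin a ↔ Fin b
Fin-cong refl = K-reflexive refl

T-b2n : ∀ b → T b ↔ Fin (b2n b)
T-b2n true  = SK-sym 1↔⊤
T-b2n false = SK-sym 0↔⊥

Σ-T-transport : ∀ {A B : Set} (p : A → Bool) (q : B → Bool) (f : A → B) (g : B → A) →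
                (∀ b → f (g b) ≡ b) → (∀ a → g (f a) ≡ a) → (∀ a → q (f a) ≡ p a) →
                Σ A (T ∘ p) ↔ Σ B (T ∘ q)
Σ-T-transport p q f g fg gf qf = Σ-↔ (mk↔ₛ′ f g fg gf) λ {a} → K-reflexive (cong T (sym (qf a)))

Σ-Fin-tally : ∀ m (h : ℕ → Bool) → Σ (Fin m) (λ j → T (h (m ∸ toℕ j))) ↔ Fin (tally h m)
Σ-Fin-tally zero    h = mk↔ₛ′ (λ { (() , _) }) (λ ()) (λ ()) (λ { (() , _) })
Σ-Fin-tally (suc m) h = begin
  Σ (Fin (suc m)) (λ j → T (h (suc m ∸ toℕ j)))          ↔⟨ split ⟩
  (T (h (suc m)) ⊎ Σ (Fin m) (λ j → T (h (m ∸ toℕ j))))  ↔⟨ T-b2n (h (suc m)) ⊎-cong Σ-Fin-tally m h ⟩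
  (Fin (b2n (h (suc m))) ⊎ Fin (tally h m))               ↔⟨ SK-sym +↔⊎ ⟩
  Fin (tally h (suc m))                                   ∎
  where
    open EquationalReasoning
    split = mk↔ₛ′ (λ { (fzero , t) → inj₁ t ; (fsuc j , t) → inj₂ (j , t) })
                  (λ { (inj₁ t) → fzero , t ; (inj₂ (j , t)) → fsuc j , t })
                  (λ { (inj₁ _) → refl ; (inj₂ _) → refl }) (λ { (fzero , _) → refl ; (fsuc _ , _) → refl })

pascal : ∀ n l → (n + suc l) C suc l + (suc n + l) C l ≡ (suc n + suc l) C suc l
pascal n l = begin
  (n + suc l) C suc l + (suc n + l) C l       ≡⟨ +-comm ((n + suc l) C suc l) _ ⟩
  (suc n + l) C l + (n + suc l) C suc l       ≡⟨ cong (λ i → i C l + (n + suc l) C suc l) (sym (+-suc n l)) ⟩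
  (n + suc l) C l + (n + suc l) C suc l       ≡⟨ nCk+nC[k+1]≡[n+1]C[k+1] (n + suc l) l ⟩
  (suc n + suc l) C suc l                     ∎
  where open ≡-Reasoning

Paths-count : ∀ n l → Paths n l ↔ Fin ((n + l) C l)
Paths-count zero zero = mk↔ₛ′ (λ _ → fzero) (λ _ → [] , refl , refl) (λ { fzero → refl ; (fsuc ()) })
  (λ { ([] , refl , refl) → refl ; (U ∷ _ , _ , ()) ; (R ∷ _ , () , _) })
Paths-count zero (suc l) = begin
  Paths 0 (suc l)      ↔⟨ mk↔ₛ′ (λ { (U ∷ Q , r , u) → Q , r , suc-injective u ; (R ∷ _ , () , _) ; ([] , _ , ()) })
                                (λ { (Q , r , u) → U ∷ Q , r , cong suc u }) (λ _ → Paths-≡ refl)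
                                (λ { (U ∷ _ , _ , _) → Paths-≡ refl ; (R ∷ _ , () , _) ; ([] , _ , ()) }) ⟩
  Paths 0 l            ↔⟨ Paths-count 0 l ⟩
  Fin (l C l)          ↔⟨ Fin-cong (trans (nCn≡1 l) (sym (nCn≡1 (suc l)))) ⟩
  Fin (suc l C suc l)  ∎
  where open EquationalReasoning
Paths-count (suc n) zero = begin
  Paths (suc n) 0      ↔⟨ mk↔ₛ′ (λ { (R ∷ Q , r , u) → Q , suc-injective r , u ; (U ∷ _ , _ , ()) ; ([] , () , _) })
                                (λ { (Q , r , u) → R ∷ Q , cong suc r , u }) (λ _ → Paths-≡ refl)
                                (λ { (R ∷ _ , _ , _) → Paths-≡ refl ; (U ∷ _ , _ , ()) ; ([] , () , _) }) ⟩
  Paths n 0            ↔⟨ Paths-count n 0 ⟩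
  Fin ((n + 0) C 0)    ↔⟨ Fin-cong refl ⟩
  Fin ((suc n + 0) C 0) ∎
  where open EquationalReasoning
Paths-count (suc n) (suc l) = begin
  Paths (suc n) (suc l)                                    ↔⟨ firstStep ⟩
  (Paths n (suc l) ⊎ Paths (suc n) l)                      ↔⟨ Paths-count n (suc l) ⊎-cong Paths-count (suc n) l ⟩
  (Fin ((n + suc l) C suc l) ⊎ Fin ((suc n + l) C l))      ↔⟨ SK-sym +↔⊎ ⟩
  Fin ((n + suc l) C suc l + (suc n + l) C l)              ↔⟨ Fin-cong (pascal n l) ⟩
  Fin ((suc n + suc l) C suc l)                            ∎
  where
    open EquationalReasoning
    firstStep : Paths (suc n) (suc l) ↔ (Paths n (suc l) ⊎ Paths (suc n) l)
    firstStep = mk↔ₛ′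
      (λ { (R ∷ Q , r , u) → inj₁ (Q , suc-injective r , u)
         ; (U ∷ Q , r , u) → inj₂ (Q , r , suc-injective u)
         ; ([] , () , _) })
      (λ { (inj₁ (Q , r , u)) → R ∷ Q , cong suc r , u ; (inj₂ (Q , r , u)) → U ∷ Q , r , cong suc u })
      (λ { (inj₁ _) → cong inj₁ (Paths-≡ refl) ; (inj₂ _) → cong inj₂ (Paths-≡ refl) })
      (λ { (R ∷ _ , _ , _) → Paths-≡ refl ; (U ∷ _ , _ , _) → Paths-≡ refl ; ([] , () , _) })

endFrom-counts : ∀ x y P → endFrom (x , y) P ≡ (x + Rs.count P , y + Ups.count P)
endFrom-counts x y []      = cong₂ _,_ (sym (+-identityʳ x)) (sym (+-identityʳ y))
endFrom-counts x y (U ∷ P) = trans (endFrom-counts x (suc y) P) (cong (x + Rs.count P ,_) (sym (+-suc y (Ups.count P))))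
endFrom-counts x y (R ∷ P) = trans (endFrom-counts (suc x) y P) (cong (_, y + Ups.count P) (sym (+-suc x (Rs.count P))))

Σ-T-≡ : ∀ {A : Set} (p : A → Bool) {x y : A} {t : T (p x)} {t′ : T (p y)} →
        x ≡ y → _≡_ {A = Σ A (T ∘ p)} (x , t) (y , t′)
Σ-T-≡ p refl = cong (_ ,_) (T-irrelevant _ _)

DominatedPt-irrelevant : ∀ {m} (c : Fin m → ℕ) {p} (d d′ : DominatedPt c p) → d ≡ d′
DominatedPt-irrelevant c (a , b) (a′ , b′) = cong₂ _,_ (≤-irrelevant a a′) (≤-irrelevant b b′)

module Count (m′ n l : ℕ) (a : Fin (suc m′) → ℕ) (total≡ : total a ≡ suc n) (l<m : l < suc m′) where
  m : ℕ
  m = suc m′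

  B₀ : List Step
  B₀ = boundary a

  Bⱼ : Fin m → List Step
  Bⱼ j = boundary (shift a j)

  -- B₀ and every Bⱼ are boundary words; Bⱼ has the right number of right steps because it
  -- is a rotation of B₀.
  B₀-word : BoundaryWord m n B₀
  B₀-word = Ups-boundary a , trans (Rs-boundary a) total≡ , boundary-ends a

  Bⱼ-word : ∀ j → BoundaryWord m n (Bⱼ j)
  Bⱼ-word j = Ups-boundary (shift a j)
            , trans (sym (count-rotate isU isR (toℕ j) (Bⱼ j)))
                    (trans (cong Rs.count (rotate-boundary-shift a j)) (proj₁ (proj₂ B₀-word)))
            , boundary-ends (shift a j)

  isGood : Fin m → Paths n l → Bool
  isGood j Q = ballot 0 (merged (Bⱼ j) (proj₁ Q))

  rotatedGood : Fin m → Paths n l → Bool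
  rotatedGood j Q = rotationBallot (merged B₀ (proj₁ Q)) (m ∸ toℕ j)

  unpack : GStar a (suc n , l) ↔ Σ (Fin m) λ j → Σ (Paths n l) (T ∘ isGood j)
  unpack = mk↔ₛ′ to from to-from from-to
    where
      to : GStar a (suc n , l) → Σ (Fin m) λ j → Σ (Paths n l) (T ∘ isGood j)
      to ((.(Q ++ [ R ]) , j) , e , (Q , refl) , g) =
        j , (Q , suc-injective (trans (sym (Rs-∷ʳR Q)) (cong proj₁ e′)) , trans (sym (Ups-∷ʳR Q)) (cong proj₂ e′))
          , dominated⇒ballot₀ (shift a j) (Q ++ [ R ]) g
        where e′ = trans (sym (endFrom-counts 0 0 (Q ++ [ R ]))) e
      from : (Σ (Fin m) λ j → Σ (Paths n l) (T ∘ isGood j)) → GStar a (suc n , l)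
      from (j , (Q , r , u) , t) =
        (Q ++ [ R ] , j)
          , trans (endFrom-counts 0 0 (Q ++ [ R ])) (cong₂ _,_ (trans (Rs-∷ʳR Q) (cong suc r)) (trans (Ups-∷ʳR Q) u))
          , (Q , refl) , ballot⇒dominated₀ (shift a j) (Q ++ [ R ]) t
      to-from : ∀ x → to (from x) ≡ x
      to-from (j , Q , t) = cong (j ,_) (Σ-T-≡ (isGood j) (Paths-≡ refl))
      from-to : ∀ x → from (to x) ≡ x
      from-to ((.(Q ++ [ R ]) , j) , e , (Q , refl) , g) =
        cong₂ (λ e g → (Q ++ [ R ] , j) , e , (Q , refl) , g)
              (Decidable⇒UIP.≡-irrelevant (×-≡-dec _≟_ _≟_) _ _)
              (All.irrelevant (DominatedPt-irrelevant (shift a j)) _ _)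

  module _ (j : Fin m) where
    private
      k = toℕ j
      k≤m : k ≤ m
      k≤m = <⇒≤ (toℕ<n j)
      module Rⱼ = RotatePaths (Bⱼ-word j)
      module R₀ = RotatePaths B₀-word

    Bⱼ-to-B₀ : Ups.rotate k (Bⱼ j) ≡ B₀
    Bⱼ-to-B₀ = rotate-boundary-shift a j

    B₀-to-Bⱼ : Ups.rotate (m ∸ k) B₀ ≡ Bⱼ j
    B₀-to-Bⱼ = trans (cong (Ups.rotate (m ∸ k)) (sym Bⱼ-to-B₀))
                     (Ups.rotate-inverse m k (Bⱼ j) (proj₁ (Bⱼ-word j)) k≤m (proj₂ (proj₂ (Bⱼ-word j))))

    forward : Paths n l → Paths n l
    forward (Q , r , u) = rotatePath k (Bⱼ j) Q , Rⱼ.Rs-rotatePath r k k≤m , trans (Rⱼ.Ups-rotatePath r k k≤m) u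

    backward : Paths n l → Paths n l
    backward (Q , r , u) = rotatePath (m ∸ k) B₀ Q , R₀.Rs-rotatePath r (m ∸ k) (m∸n≤m m k)
                         , trans (R₀.Ups-rotatePath r (m ∸ k) (m∸n≤m m k)) u

    forward-backward : ∀ Q → forward (backward Q) ≡ Q
    forward-backward (Q , r , u) = Paths-≡ (subst₂ (λ i B → rotatePath i B (rotatePath (m ∸ k) B₀ Q) ≡ Q)
      (m∸[m∸n]≡n k≤m) B₀-to-Bⱼ (R₀.rotatePath-inverse r (m ∸ k) (m∸n≤m m k)))

    backward-forward : ∀ Q → backward (forward Q) ≡ Q
    backward-forward (Q , r , u) = Paths-≡ (subst (λ B → rotatePath (m ∸ k) B (rotatePath k (Bⱼ j) Q) ≡ Q)
      Bⱼ-to-B₀ (Rⱼ.rotatePath-inverse r k k≤m))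

    rotatedGood-forward : ∀ Q → rotatedGood j (forward Q) ≡ isGood j Q
    rotatedGood-forward (Q , r , u) = cong (ballot 0)
      (subst (λ B → BUps.rotate (m ∸ k) (merged B (rotatePath k (Bⱼ j) Q)) ≡ merged (Bⱼ j) Q)
             Bⱼ-to-B₀ (Rⱼ.rotate-back r k k≤m))

    good⇔rotatedGood : Σ (Paths n l) (T ∘ isGood j) ↔ Σ (Paths n l) (T ∘ rotatedGood j)
    good⇔rotatedGood = Σ-T-transport (isGood j) (rotatedGood j) forward backward
                                     forward-backward backward-forward rotatedGood-forward

  rotations-good : ∀ Q → Σ (Fin m) (λ j → T (rotatedGood j Q)) ↔ Fin (m ∸ l)
  rotations-good (Q , r , u) = begin
    Σ (Fin m) (λ j → T (rotatedGood j (Q , r , u)))  ↔⟨ Σ-Fin-tally m (rotationBallot (merged B₀ Q)) ⟩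
    Fin (tally (rotationBallot (merged B₀ Q)) m)      ↔⟨ Fin-cong (cycle-lemma l m (merged B₀ Q) bUps pUps (<⇒≤ l<m)) ⟩
    Fin (m ∸ l)                                       ∎
    where
      open EquationalReasoning
      bUps = RotatePaths.bUps-L B₀-word r
      pUps = trans (RotatePaths.pUps-L B₀-word r) u

lemma3 : (m n l : ℕ) (a : Fin m → ℕ) → total a ≡ n → 1 ≤ n → l < m →
    GStar a (n , l) ↔ Fin (((n + l ∸ 1) C l) * (m ∸ l))
lemma3 zero     n       l a _      _  ()
lemma3 (suc m′) zero    l a _      () _
lemma3 (suc m′) (suc n) l a total≡ _  l<m = begin
  GStar a (suc n , l)                                            ↔⟨ unpack ⟩
  Σ (Fin m) (λ j → Σ (Paths n l) (T ∘ isGood j))                 ↔⟨ Σ-↔ K-refl (λ {j} → good⇔rotatedGood j) ⟩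
  Σ (Fin m) (λ j → Σ (Paths n l) (T ∘ rotatedGood j))            ↔⟨ ∃∃↔∃∃ (λ j Q → T (rotatedGood j Q)) ⟩
  Σ (Paths n l) (λ Q → Σ (Fin m) (λ j → T (rotatedGood j Q)))    ↔⟨ Σ-↔ K-refl (λ {Q} → rotations-good Q) ⟩
  (Paths n l × Fin (m ∸ l))                                      ↔⟨ Paths-count n l ×-cong K-refl ⟩
  (Fin ((n + l) C l) × Fin (m ∸ l))                              ↔⟨ SK-sym *↔× ⟩
  Fin (((n + l) C l) * (m ∸ l))                                  ∎
  where
    open Count m′ n l a total≡ l<m
    open EquationalReasoning
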